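{- Let $D$ be a signed digraph on $[n]$ having at least one non-negative cycle, let $\gamma^+$ be its non-negative girth, and let $s\ge2$. For any $f\in F(D,s)$, any two distinct elements of $\mathrm{Fix}(f)$ are at Hamming distance at least $\gamma^+$. Thus \[ g(D,s)\le\log_s A_{\mathrm H}(n,\gamma^+,s). \] Moreover, if $D$ is negative (all arcs have sign $-1$), then \[ g(D,s)\le\log_s A_{\mathrm m}\!\left(n,\frac{\gamma^+}{2},s\right); \] and if $D$ is positive (all arcs have sign $+1$), then \[ g(D,s)\le\log_s A_{\mathrm M}(n,\gamma^+,s). \]
   Context: A signed digraph on $[n]=\{0,\dots,n-1\}$ is $D=([n],E,\lambda)$ with $E\subseteq[n]\times[n]$ (loops allowed) and $\lambda:E\to\{ -1,0,1\}$. For $i\in[n]$, $N^\alpha(i)=\{j:(j,i)\in E,\lambda(j,i)=\alpha\}$ and $N(i)$ is their union. $[s]=\{0,\dots,s-1\}$. $F(D,s)$ is the set of maps $f:[s]^n\to[s]^n$ such that each $f_i$ depends only on $x_{N(i)}$, is non-decreasing in $x_j$ when $\lambda(j,i)=1$ and non-increasing in $x_j$ when $\lambda(j,i)=-1$; $\mathrm{Fix}(f)$ is the set of fixed points and $g(D,s)=\max_{f\in F(D,s)}\log_s|\mathrm{Fix}(f)|$. A cycle is a directed cycle (loops count as cycles of length 1), its sign is the product of the signs of its arcs, it is non-negative if this product is $\ge0$, and the non-negative girth $\gamma^+$ is the minimum length of a non-negative cycle. For $x,y\in[s]^n$ let $L(x,y)=|\{i:x_i<y_i\}|$, $d_{\mathrm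 H}(x,y)=L(x,y)+L(y,x)$ (Hamming distance), $d_{\mathrm M}(x,y)=\max\{L(x,y),L(y,x)\}$, $d_{\mathrm m}(x,y)=\min\{L(x,y),L(y,x)\}$. For $\mu\in\{\mathrm H,\mathrm M,\mathrm m\}$, $A_\mu(n,d,s)$ is the maximum cardinality of a set $\mathcal C\subseteq[s]^n$ with $d_\mu(c,c')\ge d$ for all distinct $c,c'\in\mathcal C$. -}

module Defs where

open import Data.Nat using (ℕ; zero; suc; _≤_; _<_; _≤?_; _<?_; _⊔_; _+_)
open import Data.Fin using (Fin; toℕ)
open import Data.Fin.Properties using () renaming (_≟_ to _≟ᶠ_)
open import Data.Vec using (Vec; []; _∷_; lookup)
open import Data.Vec.Properties using (≡-dec)
open import Data.List using (List; []; _∷_; [_]; _++_; map; concatMap; filter; length; allFin; foldr)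
open import Data.List.Relation.Unary.AllPairs using (AllPairs; allPairs?)
open import Data.List.Relation.Unary.Unique.Propositional using (Unique)
open import Data.Maybe using (Maybe; just; nothing; _>>=_)
import Data.Maybe as M
open import Data.Product using (Σ; _×_; ∃)
open import Relation.Binary.PropositionalEquality using (_≡_; _≢_)

data Sign : Set where
  neg zer pos : Sign

_·ˢ_ : Sign → Sign → Sign
zer ·ˢ _   = zer
_   ·ˢ zer = zer
pos ·ˢ σ   = σ
neg ·ˢ pos = neg
neg ·ˢ neg = pos

signProduct : List Sign → Sign
signProduct = foldr _·ˢ_ pos

NonNegSign : Sign → Set
NonNegSign σ = σ ≢ neg

-- Signed digraph on [n]: arc j i ≡ just σ  iff  (j,i) ∈ E with λ(j,i) = σ;
-- arc j i ≡ nothing iff (j,i) ∉ E.  Loops allowed.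
record SignedDigraph (n : ℕ) : Set where
  field
    arc : Fin n → Fin n → Maybe Sign
open SignedDigraph public

Conf : ℕ → ℕ → Set
Conf n s = Vec (Fin s) n

record InF {n : ℕ} (D : SignedDigraph n) (s : ℕ) (f : Conf n s → Conf n s) : Set where
  field
    local : ∀ (i : Fin n) (x y : Conf n s) →
      (∀ j → arc D j i ≢ nothing → lookup x j ≡ lookup y j) →
      lookup (f x) i ≡ lookup (f y) i
    mono : ∀ (i j : Fin n) → arc D j i ≡ just pos → ∀ (x y : Conf n s) →
      (∀ k → k ≢ j → lookup x k ≡ lookup y k) →
      toℕ (lookup x j) ≤ toℕ (lookup y j) →
      toℕ (lookup (f x) i) ≤ toℕ (lookup (f y) i)
    anti : ∀ (i j : Fin n) → arc D j i ≡ just neg → ∀ (x y : Conf n s) →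
      (∀ k → k ≢ j → lookup x k ≡ lookup y k) →
      toℕ (lookup x j) ≤ toℕ (lookup y j) →
      toℕ (lookup (f y) i) ≤ toℕ (lookup (f x) i)

allConfs : (n s : ℕ) → List (Conf n s)
allConfs zero s = [ [] ]
allConfs (suc n) s = concatMap (λ a → map (a ∷_) (allConfs n s)) (allFin s)

numFix : {n s : ℕ} → (Conf n s → Conf n s) → ℕ
numFix {n} {s} f = length (filter (λ x → ≡-dec _≟ᶠ_ (f x) x) (allConfs n s))

L : {n s : ℕ} → Conf n s → Conf n s → ℕ
L {n} x y = length (filter (λ i → toℕ (lookup x i) <? toℕ (lookup y i)) (allFin n))

dH dM dm : {n s : ℕ} → Conf n s → Conf n s → ℕ
dH x y = L x y + L y x
dM x y = L x y ⊔ L y x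
dm x y = Data.Nat._⊓_ (L x y) (L y x)

-- all sublists (subsets, as lists of pairwise distinct elements of allConfs)
sublists : {A : Set} → List A → List (List A)
sublists [] = [ [] ]
sublists (x ∷ xs) = map (x ∷_) (sublists xs) ++ sublists xs

maxList : List ℕ → ℕ
maxList = foldr _⊔_ 0

A : (dist : ∀ {n s} → Conf n s → Conf n s → ℕ) → (n d s : ℕ) → ℕ
A dist n d s = maxList (map length
  (filter (allPairs? (λ c c' → d ≤? dist c c')) (sublists (allConfs n s))))

-- cycles: a cycle is a nonempty list of distinct vertices v0 … v(k-1)
-- with arcs v0→v1→…→v(k-1)→v0; its length is k.
pathSigns : {n : ℕ} → SignedDigraph n → List (Fin n) → Maybe (List Sign)
pathSigns D [] = just []
pathSigns D (v ∷ []) = just []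
pathSigns D (u ∷ v ∷ vs) = arc D u v >>= λ σ → M.map (σ ∷_) (pathSigns D (v ∷ vs))

cycleSigns : {n : ℕ} → SignedDigraph n → List (Fin n) → Maybe (List Sign)
cycleSigns D [] = nothing
cycleSigns D (v ∷ vs) = pathSigns D ((v ∷ vs) ++ [ v ])

NonNegCycle : {n : ℕ} → SignedDigraph n → List (Fin n) → Set
NonNegCycle D vs = Unique vs × ∃ λ σs → cycleSigns D vs ≡ just σs × NonNegSign (signProduct σs)

IsNonNegGirth : {n : ℕ} → SignedDigraph n → ℕ → Set
IsNonNegGirth D γ =
  (∃ λ vs → NonNegCycle D vs × length vs ≡ γ) ×
  (∀ vs → NonNegCycle D vs → γ ≤ length vs)

NegativeD PositiveD : {n : ℕ} → SignedDigraph n → Set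
NegativeD D = ∀ j i σ → arc D j i ≡ just σ → σ ≡ neg
PositiveD D = ∀ j i σ → arc D j i ≡ just σ → σ ≡ pos

-- Let x ≠ y be fixed points of f ∈ F(D, s), and orient every coordinate v where they
-- differ as "up" (x_v < y_v) or "down".  Local monotonicity of f (`oriented-in-neighbour`)
-- shows that each differing coordinate i has an in-neighbour j, also differing, whose arc
-- (j, i) is compatible: a positive arc keeps the orientation, a negative one flips it, a
-- zero arc allows anything.  Walking backwards along compatible arcs (`CycleSearch`) closes
-- a duplicate-free cycle of differing coordinates; the product of its signs maps the
-- orientation of a vertex to itself, so the cycle is non-negative and has length ≥ γ⁺.
-- Counting its up and down vertices (`Counting`) gives γ⁺ ≤ d_H(x, y) in general,
-- γ⁺ ≤ d_M(x, y) when all arcs are positive (orientation is constant along the cycle), and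
-- γ⁺ ≤ 2 d_m(x, y) when all arcs are negative (orientation alternates).  Finally a set of
-- fixed points with pairwise distance ≥ d is a code, so |Fix(f)| ≤ A(n, d, s) (`numFix≤A`).
module Submission where

open import Defs
open import Data.Bool using (Bool; true; false; not)
open import Data.Bool.Properties using (not-involutive)
open import Data.Nat using (ℕ; zero; suc; _≤_; _<_; _≤?_; _<?_; _+_; z≤n; s≤s; ⌈_/2⌉)
open import Data.Nat.Properties
  using (≤-refl; ≤-reflexive; ≤-trans; ≰⇒>; ≮⇒≥; <⇒≱; <⇒≯; <-irrefl; <-cmp; ≤∧≢⇒<;
         +-suc; +-identityʳ; +-comm; +-assoc; +-cancelʳ-≡; +-mono-≤;
         m≤m⊔n; m≤n⊔m; ⊓-glb; ⌈n/2⌉-mono; n≡⌈n+n/2⌉)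
open import Data.Fin using (Fin; toℕ)
open import Data.Fin.Properties using (toℕ-injective; ¬∀⟶∃¬) renaming (_≟_ to _≟ᶠ_)
open import Data.Vec using (_∷_; lookup; _[_]≔_)
open import Data.Vec.Properties
  using (≡-dec; ∷-injectiveˡ; ∷-injectiveʳ; lookup∘update; lookup∘update′;
         tabulate∘lookup; tabulate-cong)
open import Data.List using (List; []; _∷_; [_]; _++_; map; filter; length; allFin)
open import Data.List.Properties using (length-++-sucʳ; length-tabulate; filter-all)
open import Data.List.Membership.Propositional using (_∈_; _∉_)
open import Data.List.Membership.Propositional.Properties
  using (∈-∃++; ∈-++⁻; ∈-++⁺ˡ; ∈-++⁺ʳ; ∈-map⁺; ∈-map⁻; ∈-filter⁺; ∈-filter⁻;
         ∈-allFin)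
import Data.List.Membership.DecPropositional as DecMembership
open import Data.List.Relation.Unary.Any using (here; there)
open import Data.List.Relation.Unary.All as All using (All; []; _∷_)
import Data.List.Relation.Unary.All.Properties as Allₚ
open import Data.List.Relation.Unary.AllPairs as AllPairs using (AllPairs; []; _∷_; allPairs?)
import Data.List.Relation.Unary.AllPairs.Properties as AllPairsₚ
open import Data.List.Relation.Unary.Linked as Linked using (Linked; []; [-]; _∷_)
import Data.List.Relation.Unary.Linked.Properties as Linkedₚ
open import Data.List.Relation.Unary.Unique.Propositional using (Unique)
import Data.List.Relation.Unary.Unique.Propositional.Properties as Unique
open import Data.List.Relation.Binary.Disjoint.Propositional using (Disjoint)
open import Data.Maybe using (Maybe; just; nothing)
open import Data.Product using (∃; ∃₂; _×_; _,_; proj₂)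
open import Data.Sum using (_⊎_; inj₁; inj₂)
open import Data.Unit using (⊤; tt)
open import Relation.Binary.Definitions using (tri<; tri≈; tri>)
open import Relation.Nullary using (¬_; Dec; yes; no; does; ¬?; contradiction)
open import Relation.Nullary.Decidable using (dec-true; dec-false)
open import Relation.Unary using (Decidable)
open import Relation.Binary.PropositionalEquality
  using (_≡_; _≢_; refl; sym; trans; cong; subst; subst₂; module ≡-Reasoning)

unique-length-≤ : ∀ {a} {X : Set a} (ws zs : List X) → Unique ws →
  (∀ {v} → v ∈ ws → v ∈ zs) → length ws ≤ length zs
unique-length-≤ [] zs _ _ = z≤n
unique-length-≤ (w ∷ ws) zs (w∉ws ∷ uniq) ws⊆zs with ∈-∃++ (ws⊆zs (here refl))
... | pre , post , refl =
  subst (suc (length ws) ≤_) (sym (length-++-sucʳ pre w post))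
    (s≤s (unique-length-≤ ws (pre ++ post) uniq ws⊆pre++post))
  where
  ws⊆pre++post : ∀ {v} → v ∈ ws → v ∈ pre ++ post
  ws⊆pre++post {v} v∈ws with ∈-++⁻ pre (ws⊆zs (there v∈ws))
  ... | inj₁ v∈pre = ∈-++⁺ˡ v∈pre
  ... | inj₂ (here refl) = contradiction refl (All.lookup w∉ws v∈ws)
  ... | inj₂ (there v∈post) = ∈-++⁺ʳ pre v∈post

filter∈sublists : ∀ {p} {X : Set} {P : X → Set p} (P? : Decidable P) (xs : List X) →
  filter P? xs ∈ sublists xs
filter∈sublists P? [] = here refl
filter∈sublists P? (x ∷ xs) with P? x
... | yes _ = ∈-++⁺ˡ (∈-map⁺ (x ∷_) (filter∈sublists P? xs))
... | no _  = ∈-++⁺ʳ (map (x ∷_) (sublists xs)) (filter∈sublists P? xs)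

≤-maxList : ∀ {k ks} → k ∈ ks → k ≤ maxList ks
≤-maxList {ks = k ∷ ks} (here refl) = m≤m⊔n k (maxList ks)
≤-maxList {ks = k ∷ ks} (there k∈ks) = ≤-trans (≤-maxList k∈ks) (m≤n⊔m k (maxList ks))

allConfs-unique : ∀ n s → Unique (allConfs n s)
allConfs-unique zero s = [] ∷ []
allConfs-unique (suc n) s =
  Unique.concat⁺ (Allₚ.map⁺ (All.universal (λ a → Unique.map⁺ ∷-injectiveʳ rest) _))
                 (AllPairsₚ.map⁺ (AllPairs.map disjoint (Unique.allFin⁺ s)))
  where
  rest : Unique (allConfs n s)
  rest = allConfs-unique n s
  disjoint : ∀ {a b} → a ≢ b → Disjoint (map (a ∷_) (allConfs n s)) (map (b ∷_) (allConfs n s))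
  disjoint a≢b (v∈a , v∈b) with ∈-map⁻ (_ ∷_) v∈a | ∈-map⁻ (_ ∷_) v∈b
  ... | _ , _ , refl | _ , _ , eq = a≢b (∷-injectiveˡ eq)

unique⇒allPairs : ∀ {a r} {X : Set a} {R : X → X → Set r} {xs : List X} → Unique xs →
  (∀ {x y} → x ∈ xs → y ∈ xs → x ≢ y → R x y) → AllPairs R xs
unique⇒allPairs [] _ = []
unique⇒allPairs (x∉xs ∷ uniq) R-distinct =
  All.tabulate (λ y∈xs → R-distinct (here refl) (there y∈xs) (All.lookup x∉xs y∈xs))
  ∷ unique⇒allPairs uniq (λ x∈ y∈ → R-distinct (there x∈) (there y∈))

numFix≤A : ∀ {n s} (f : Conf n s → Conf n s)
  (dist : ∀ {n s} → Conf n s → Conf n s → ℕ) (d : ℕ) →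
  (∀ x y → f x ≡ x → f y ≡ y → x ≢ y → d ≤ dist x y) → numFix f ≤ A dist n d s
numFix≤A {n} {s} f dist d separated =
  ≤-maxList (∈-map⁺ length (∈-filter⁺ (allPairs? (λ c c′ → d ≤? dist c c′))
                                      (filter∈sublists fixed? (allConfs n s)) code))
  where
  fixed? : Decidable (λ x → f x ≡ x)
  fixed? x = ≡-dec _≟ᶠ_ (f x) x
  isFixed : ∀ {x} → x ∈ filter fixed? (allConfs n s) → f x ≡ x
  isFixed x∈ = proj₂ (∈-filter⁻ fixed? {xs = allConfs n s} x∈)
  code : AllPairs (λ c c′ → d ≤ dist c c′) (filter fixed? (allConfs n s))
  code = unique⇒allPairs (Unique.filter⁺ fixed? (allConfs-unique n s))
           (λ x∈ y∈ → separated _ _ (isFixed x∈) (isFixed y∈))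

-- The position of a coordinate value a (in x) relative to b (in y) that, through an
-- arc carrying label ℓ into i, cannot make f_i(x) exceed f_i(y).
Below : ∀ {s} → Maybe Sign → Fin s → Fin s → Set
Below nothing    _ _ = ⊤
Below (just zer) a b = a ≡ b
Below (just pos) a b = toℕ a ≤ toℕ b
Below (just neg) a b = toℕ b ≤ toℕ a

Below-refl : ∀ {s} ℓ (a : Fin s) → Below ℓ a a
Below-refl nothing    a = tt
Below-refl (just zer) a = refl
Below-refl (just pos) a = ≤-refl
Below-refl (just neg) a = ≤-refl

Below? : ∀ {s} ℓ (a b : Fin s) → Dec (Below ℓ a b)
Below? nothing    a b = yes tt
Below? (just zer) a b = a ≟ᶠ b
Below? (just pos) a b = toℕ a ≤? toℕ b
Below? (just neg) a b = toℕ b ≤? toℕ a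

Oriented : ∀ {s} → Sign → Fin s → Fin s → Set
Oriented zer a b = a ≢ b
Oriented pos a b = toℕ a < toℕ b
Oriented neg a b = toℕ b < toℕ a

¬Below⇒Oriented : ∀ {s} ℓ (a b : Fin s) → ¬ Below ℓ b a →
  ∃ λ σ → ℓ ≡ just σ × Oriented σ a b
¬Below⇒Oriented nothing    a b ¬below = contradiction tt ¬below
¬Below⇒Oriented (just zer) a b ¬below = zer , refl , λ a≡b → ¬below (sym a≡b)
¬Below⇒Oriented (just pos) a b ¬below = pos , refl , ≰⇒> ¬below
¬Below⇒Oriented (just neg) a b ¬below = neg , refl , ≰⇒> ¬below

module Comparison {n s : ℕ} (D : SignedDigraph n) {f : Conf n s → Conf n s} (inF : InF D s f) where
  open InF inF

  _at_ : Conf n s → Fin n → ℕ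
  x at i = toℕ (lookup x i)

  single-step : ∀ i k (x z : Conf n s) → (∀ j → j ≢ k → lookup x j ≡ lookup z j) →
    Below (arc D k i) (lookup x k) (lookup z k) → f x at i ≤ f z at i
  single-step i k x z off-k below with arc D k i in arc≡
  ... | nothing = ≤-reflexive (cong toℕ (local i x z agree))
    where
    agree : ∀ j → arc D j i ≢ nothing → lookup x j ≡ lookup z j
    agree j j∈N with j ≟ᶠ k
    ... | yes refl = contradiction arc≡ j∈N
    ... | no j≢k   = off-k j j≢k
  ... | just zer = ≤-reflexive (cong toℕ (local i x z agree))
    where
    agree : ∀ j → arc D j i ≢ nothing → lookup x j ≡ lookup z j
    agree j _ with j ≟ᶠ k
    ... | yes refl = below
    ... | no j≢k   = off-k j j≢k
  ... | just pos = mono i k arc≡ x z off-k below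
  ... | just neg = anti i k arc≡ z x (λ j j≢k → sym (off-k j j≢k)) below

  -- Monotone comparison: if every in-neighbour of i sits Below from x to y, then f_i(x) ≤ f_i(y).
  -- Proved by changing the coordinates in ks one at a time, turning x into y.
  compare-along : ∀ i (ks : List (Fin n)) (x y : Conf n s) →
    (∀ j → j ∉ ks → lookup x j ≡ lookup y j) →
    (∀ j → Below (arc D j i) (lookup x j) (lookup y j)) → f x at i ≤ f y at i
  compare-along i [] x y same _ = ≤-reflexive (cong toℕ (local i x y (λ j _ → same j λ ())))
  compare-along i (k ∷ ks) x y same below =
    ≤-trans (single-step i k x z off-k (subst (Below (arc D k i) (lookup x k)) (sym z-k) (below k)))
            (compare-along i ks z y same′ below′)
    where
    z : Conf n s
    z = x [ k ]≔ lookup y k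
    z-k : lookup z k ≡ lookup y k
    z-k = lookup∘update k x (lookup y k)
    off-k : ∀ j → j ≢ k → lookup x j ≡ lookup z j
    off-k j j≢k = sym (lookup∘update′ j≢k x (lookup y k))
    same′ : ∀ j → j ∉ ks → lookup z j ≡ lookup y j
    same′ j j∉ks with j ≟ᶠ k
    ... | yes refl = z-k
    ... | no j≢k   = trans (sym (off-k j j≢k))
                           (same j λ { (here j≡k) → j≢k j≡k ; (there j∈ks) → j∉ks j∈ks })
    below′ : ∀ j → Below (arc D j i) (lookup z j) (lookup y j)
    below′ j with j ≟ᶠ k
    ... | yes refl = subst (λ a → Below (arc D j i) a (lookup y j)) (sym z-k) (Below-refl _ _)
    ... | no j≢k   = subst (λ a → Below (arc D j i) a (lookup y j)) (off-k j j≢k) (below j)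

  comparison : ∀ i (x y : Conf n s) → (∀ j → Below (arc D j i) (lookup x j) (lookup y j)) →
    f x at i ≤ f y at i
  comparison i x y = compare-along i (allFin n) x y (λ j j∉ → contradiction (∈-allFin j) j∉)

  oriented-in-neighbour : ∀ i (x y : Conf n s) → f x at i < f y at i →
    ∃₂ λ j σ → arc D j i ≡ just σ × Oriented σ (lookup x j) (lookup y j)
  oriented-in-neighbour i x y fx<fy
    with ¬∀⟶∃¬ n _ (λ j → Below? (arc D j i) (lookup y j) (lookup x j))
                   (λ below → <⇒≱ fx<fy (comparison i y x below))
  ... | j , ¬below with ¬Below⇒Oriented (arc D j i) _ _ ¬below
  ... | σ , arc≡ , oriented = j , σ , arc≡ , oriented

-- A sign read as a relation between the orientations (true = up) of the two ends of an arc: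
-- a positive arc preserves the orientation, a negative one flips it, a zero arc constrains nothing.
Transmits : Sign → Bool → Bool → Set
Transmits zer _ _ = ⊤
Transmits pos a b = a ≡ b
Transmits neg a b = a ≡ not b

Transmits-· : ∀ σ τ {a b c} → Transmits σ a b → Transmits τ b c → Transmits (σ ·ˢ τ) a c
Transmits-· zer τ   _    _    = tt
Transmits-· pos zer _    _    = tt
Transmits-· pos pos refl refl = refl
Transmits-· pos neg refl b≡c  = b≡c
Transmits-· neg zer _    _    = tt
Transmits-· neg pos a≡b  refl = a≡b
Transmits-· neg neg {c = c} refl refl = not-involutive c

Transmits-loop : ∀ σ a → Transmits σ a a → NonNegSign σ
Transmits-loop neg true  () refl
Transmits-loop neg false () refl

module Compatibility {n : ℕ} (D : SignedDigraph n) (dir : Fin n → Bool) where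

  Compatible : Fin n → Fin n → Set
  Compatible j i = ∃ λ σ → arc D j i ≡ just σ × Transmits σ (dir j) (dir i)

  compatible-uniform : ∀ τ → (∀ j i σ → arc D j i ≡ just σ → σ ≡ τ) →
    ∀ {j i} → Compatible j i → Transmits τ (dir j) (dir i)
  compatible-uniform τ uniform {j} {i} (σ , arc≡ , t) =
    subst (λ ρ → Transmits ρ (dir j) (dir i)) (uniform j i σ arc≡) t

  walk-sign : ∀ u ws w → Linked Compatible (u ∷ ws ++ [ w ]) →
    ∃ λ σs → pathSigns D (u ∷ ws ++ [ w ]) ≡ just σs × Transmits (signProduct σs) (dir u) (dir w)
  walk-sign u [] w ((σ , arc≡ , t) ∷ [-]) rewrite arc≡ = σ ∷ [] , refl , Transmits-· σ pos t refl
  walk-sign u (v ∷ ws) w ((σ , arc≡ , t) ∷ rest) with walk-sign v ws w rest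
  ... | σs , signs≡ , t′ rewrite arc≡ | signs≡ =
    σ ∷ σs , refl , Transmits-· σ (signProduct σs) t t′

  compatible-cycle : ∀ v vs → Unique (v ∷ vs) → Linked Compatible (v ∷ vs ++ [ v ]) →
    NonNegCycle D (v ∷ vs)
  compatible-cycle v vs unique linked with walk-sign v vs v linked
  ... | σs , signs≡ , t = unique , σs , signs≡ , Transmits-loop (signProduct σs) (dir v) t

unique-length-≤-n : ∀ {n} (ws : List (Fin n)) → Unique ws → length ws ≤ n
unique-length-≤-n {n} ws unique =
  subst (length ws ≤_) (length-tabulate (λ k → k))
        (unique-length-≤ ws (allFin n) unique (λ {v} _ → ∈-allFin v))

unique-within : ∀ {n q} {Q : Fin n → Set q} (Q? : Decidable Q) (ws : List (Fin n)) →
  Unique ws → All Q ws → length ws ≤ length (filter Q? (allFin n))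
unique-within Q? ws unique all-Q =
  unique-length-≤ ws _ unique (λ w∈ → ∈-filter⁺ Q? (∈-allFin _) (All.lookup all-Q w∈))

unique-loop : ∀ {a} {X : Set a} (pre : List X) {j post} → Unique (pre ++ j ∷ post) → Unique (j ∷ pre)
unique-loop [] _ = [] ∷ []
unique-loop (a ∷ pre) {j} (a∉ ∷ unique) with unique-loop pre unique
... | j∉pre ∷ unique-pre = (j≢a ∷ j∉pre) ∷ Allₚ.++⁻ˡ pre a∉ ∷ unique-pre
  where
  j≢a : j ≢ a
  j≢a j≡a = All.head (Allₚ.++⁻ʳ pre a∉) (sym j≡a)

linked-prefix : ∀ {a r} {X : Set a} {R : X → X → Set r} (pre : List X) {j post} →
  Linked R (pre ++ j ∷ post) → Linked R (pre ++ [ j ])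
linked-prefix []            _        = [-]
linked-prefix (a ∷ [])      (r ∷ _)  = r ∷ [-]
linked-prefix (a ∷ b ∷ pre) (r ∷ rs) = r ∷ linked-prefix (b ∷ pre) rs

record Cycle {n : ℕ} (P : Fin n → Set) (E : Fin n → Fin n → Set) : Set where
  field
    start    : Fin n
    rest     : List (Fin n)
    unique   : Unique (start ∷ rest)
    inside   : All P (start ∷ rest)
    closed   : Linked E (start ∷ rest ++ [ start ])

  vertices : List (Fin n)
  vertices = start ∷ rest

-- If every vertex of P has an E-predecessor in P, then walking backwards from any vertex
-- of P must revisit a vertex within n steps, which closes a cycle in P.
module CycleSearch {n : ℕ} {P : Fin n → Set} {E : Fin n → Fin n → Set}
                   (predecessor : ∀ {i} → P i → ∃ λ j → E j i × P j) where
  open DecMembership (_≟ᶠ_ {n}) using (_∈?_)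

  -- The walk h ∷ t (arcs pointing forward) is kept duplicate-free; the fuel bounds how often
  -- it can still grow.  When the predecessor j of h already lies on the walk, the part of the
  -- walk before j, preceded by the arc j → h, is the cycle.
  walk-back : (fuel : ℕ) (h : Fin n) (t : List (Fin n)) → n ≤ length t + fuel →
    Unique (h ∷ t) → All P (h ∷ t) → Linked E (h ∷ t) → Cycle P E
  walk-back zero h t n≤ unique _ _ =
    contradiction (subst (n ≤_) (+-identityʳ (length t)) n≤)
                  (<⇒≱ (unique-length-≤-n (h ∷ t) unique))
  walk-back (suc fuel) h t n≤ unique inside linked with predecessor (All.head inside)
  ... | j , Ejh , Pj with j ∈? (h ∷ t)
  ...   | no j∉ = walk-back fuel j (h ∷ t) (subst (n ≤_) (+-suc (length t) fuel) n≤)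
                    (Allₚ.¬Any⇒All¬ (h ∷ t) j∉ ∷ unique) (Pj ∷ inside) (Ejh ∷ linked)
  ...   | yes j∈ with ∈-∃++ j∈
  ...     | [] , post , refl = record
    { start = j ; rest = [] ; unique = [] ∷ [] ; inside = Pj ∷ [] ; closed = Ejh ∷ [-] }
  ...     | (.h ∷ pre) , post , refl = record
    { start = j ; rest = h ∷ pre ; unique = unique-loop (h ∷ pre) unique
    ; inside = Pj ∷ Allₚ.++⁻ˡ (h ∷ pre) inside ; closed = Ejh ∷ linked-prefix (h ∷ pre) linked }

  -- Fuel n suffices, as a duplicate-free walk has at most n vertices.
  find-cycle : ∀ {i} → P i → Cycle P E
  find-cycle {i} Pi = walk-back n i [] ≤-refl ([] ∷ []) (Pi ∷ []) [-]

module Counting {a r} {A : Set a} {R : A → Set r} (R? : Decidable R) where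

  #R #¬R : List A → ℕ
  #R  ws = length (filter R? ws)
  #¬R ws = length (filter (λ u → ¬? (R? u)) ws)

  length-split : ∀ ws → length ws ≡ #R ws + #¬R ws
  length-split [] = refl
  length-split (w ∷ ws) with R? w
  ... | yes _ = cong suc (length-split ws)
  ... | no  _ = trans (cong suc (length-split ws)) (sym (+-suc (#R ws) (#¬R ws)))

  Agreeing Alternating : A → A → Set
  Agreeing    u v = does (R? u) ≡ does (R? v)
  Alternating u v = does (R? u) ≡ not (does (R? v))

  agreeing-transfer : ∀ {u v} → Agreeing u v → R u → R v
  agreeing-transfer {u} {v} agree Ru with R? u | R? v
  ... | _      | yes Rv = Rv
  ... | no ¬Ru | no _   = contradiction Ru ¬Ru
  ... | yes _  | no _   = contradiction agree λ ()

  agreeing-walk : ∀ v vs w → Linked Agreeing (v ∷ vs ++ [ w ]) → All (Agreeing v) (v ∷ vs)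
  agreeing-walk v vs w linked = Allₚ.++⁻ˡ (v ∷ vs) (Linkedₚ.Linked⇒All trans refl linked)

  agreeing-cycle : ∀ v vs → Linked Agreeing (v ∷ vs ++ [ v ]) →
    length (v ∷ vs) ≡ #R (v ∷ vs) ⊎ length (v ∷ vs) ≡ #¬R (v ∷ vs)
  agreeing-cycle v vs linked = by-start (R? v)
    where
    agree : All (Agreeing v) (v ∷ vs)
    agree = agreeing-walk v vs v linked
    by-start : Dec (R v) → length (v ∷ vs) ≡ #R (v ∷ vs) ⊎ length (v ∷ vs) ≡ #¬R (v ∷ vs)
    by-start (yes Rv) = inj₁ (sym (cong length (filter-all R?
      (All.map (λ v~u → agreeing-transfer v~u Rv) agree))))
    by-start (no ¬Rv) = inj₂ (sym (cong length (filter-all (λ u → ¬? (R? u))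
      (All.map (λ v~u Ru → ¬Rv (agreeing-transfer (sym v~u) Ru)) agree))))

  #R-∷ : ∀ u ws → #R (u ∷ ws) ≡ #R [ u ] + #R ws
  #R-∷ u ws with R? u
  ... | yes _ = refl
  ... | no  _ = refl

  #¬R-∷ : ∀ u ws → #¬R (u ∷ ws) ≡ #¬R [ u ] + #¬R ws
  #¬R-∷ u ws with R? u
  ... | yes _ = refl
  ... | no  _ = refl

  alternating-step : ∀ {u v} → Alternating u v → #R [ v ] ≡ #¬R [ u ]
  alternating-step {u} {v} alt with R? u | R? v
  ... | yes _ | yes _ = contradiction alt λ ()
  ... | yes _ | no  _ = refl
  ... | no  _ | yes _ = refl
  ... | no  _ | no  _ = contradiction alt λ ()

  alternating-walk : ∀ u ws w → Linked Alternating (u ∷ ws ++ [ w ]) →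
    #R (u ∷ ws) + #R [ w ] ≡ #¬R (u ∷ ws) + #R [ u ]
  alternating-walk u [] w (alt ∷ [-]) =
    trans (cong (#R [ u ] +_) (alternating-step alt)) (+-comm (#R [ u ]) (#¬R [ u ]))
  alternating-walk u (v ∷ ws) w (alt ∷ rest) = begin
    #R (u ∷ v ∷ ws) + #R [ w ]               ≡⟨ cong (_+ #R [ w ]) (#R-∷ u (v ∷ ws)) ⟩
    #R [ u ] + #R (v ∷ ws) + #R [ w ]        ≡⟨ +-assoc (#R [ u ]) _ _ ⟩
    #R [ u ] + (#R (v ∷ ws) + #R [ w ])      ≡⟨ cong (#R [ u ] +_) (alternating-walk v ws w rest) ⟩
    #R [ u ] + (#¬R (v ∷ ws) + #R [ v ])
      ≡⟨ cong (λ k → #R [ u ] + (#¬R (v ∷ ws) + k)) (alternating-step alt) ⟩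
    #R [ u ] + (#¬R (v ∷ ws) + #¬R [ u ])    ≡⟨ +-comm (#R [ u ]) _ ⟩
    #¬R (v ∷ ws) + #¬R [ u ] + #R [ u ]      ≡⟨ cong (_+ #R [ u ]) (+-comm (#¬R (v ∷ ws)) _) ⟩
    #¬R [ u ] + #¬R (v ∷ ws) + #R [ u ]      ≡⟨ cong (_+ #R [ u ]) (sym (#¬R-∷ u (v ∷ ws))) ⟩
    #¬R (u ∷ v ∷ ws) + #R [ u ]              ∎
    where open ≡-Reasoning

  alternating-cycle : ∀ v vs → Linked Alternating (v ∷ vs ++ [ v ]) → #R (v ∷ vs) ≡ #¬R (v ∷ vs)
  alternating-cycle v vs linked = +-cancelʳ-≡ (#R [ v ]) _ _ (alternating-walk v vs v linked)

module FixedPointPair {n s : ℕ} (D : SignedDigraph n) {f : Conf n s → Conf n s} (inF : InF D s f)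
                      {x y : Conf n s} (fx : f x ≡ x) (fy : f y ≡ y) where
  open Comparison D inF

  Differ : Fin n → Set
  Differ v = lookup x v ≢ lookup y v

  Up? : Decidable (λ v → x at v < y at v)
  Up? v = x at v <? y at v

  Down? : Decidable (λ v → y at v < x at v)
  Down? v = y at v <? x at v

  dir : Fin n → Bool
  dir v = does (Up? v)

  open Compatibility D dir
  open Counting Up?

  up-transmits : ∀ σ {j} → Oriented σ (lookup x j) (lookup y j) →
    Differ j × Transmits σ (dir j) true
  up-transmits zer x≢y = x≢y , tt
  up-transmits pos x<y = (λ x≡y → <-irrefl (cong toℕ x≡y) x<y) , dec-true (Up? _) x<y
  up-transmits neg y<x = (λ x≡y → <-irrefl (cong toℕ (sym x≡y)) y<x) , dec-false (Up? _) (<⇒≯ y<x)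

  down-transmits : ∀ σ {j} → Oriented σ (lookup y j) (lookup x j) →
    Differ j × Transmits σ (dir j) false
  down-transmits zer y≢x = (λ x≡y → y≢x (sym x≡y)) , tt
  down-transmits pos y<x = (λ x≡y → <-irrefl (cong toℕ (sym x≡y)) y<x) , dec-false (Up? _) (<⇒≯ y<x)
  down-transmits neg x<y = (λ x≡y → <-irrefl (cong toℕ x≡y) x<y) , dec-true (Up? _) x<y

  compatible-predecessor : ∀ {i} → Differ i → ∃ λ j → Compatible j i × Differ j
  compatible-predecessor {i} x≢y with <-cmp (x at i) (y at i)
  ... | tri≈ _ x≡y _ = contradiction (toℕ-injective x≡y) x≢y
  ... | tri< x<y _ _
    with oriented-in-neighbour i x y (subst₂ (λ u v → u at i < v at i) (sym fx) (sym fy) x<y)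
  ...   | j , σ , arc≡ , oriented with up-transmits σ oriented
  ...     | Dj , t = j , (σ , arc≡ , subst (Transmits σ (dir j)) (sym i-up) t) , Dj
    where
    i-up : dir i ≡ true
    i-up = dec-true (Up? i) x<y
  compatible-predecessor {i} x≢y | tri> _ _ y<x
    with oriented-in-neighbour i y x (subst₂ (λ u v → u at i < v at i) (sym fy) (sym fx) y<x)
  ... | j , σ , arc≡ , oriented with down-transmits σ oriented
  ...   | Dj , t = j , (σ , arc≡ , subst (Transmits σ (dir j)) (sym i-down) t) , Dj
    where
    i-down : dir i ≡ false
    i-down = dec-false (Up? i) (<⇒≯ y<x)

  DifferenceCycle : Set
  DifferenceCycle = Cycle Differ Compatible

  difference-cycle : x ≢ y → DifferenceCycle
  difference-cycle x≢y
    with ¬∀⟶∃¬ n _ (λ v → lookup x v ≟ᶠ lookup y v) (λ same → x≢y (extensional same))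
    where
    extensional : (∀ v → lookup x v ≡ lookup y v) → x ≡ y
    extensional same =
      trans (sym (tabulate∘lookup x)) (trans (tabulate-cong same) (tabulate∘lookup y))
  ... | i , Di = CycleSearch.find-cycle compatible-predecessor Di

  module _ (cycle : DifferenceCycle) where
    open Cycle cycle

    nonneg : NonNegCycle D vertices
    nonneg = compatible-cycle start rest unique closed

    #up≤ : #R vertices ≤ L x y
    #up≤ = unique-within Up? _ (Unique.filter⁺ Up? unique) (Allₚ.all-filter Up? vertices)

    #down≤ : #¬R vertices ≤ L y x
    #down≤ = unique-within Down? _ (Unique.filter⁺ ¬Up? unique)
      (All.zipWith down (Allₚ.all-filter ¬Up? vertices , Allₚ.filter⁺ ¬Up? inside))
      where
      ¬Up? : Decidable (λ v → ¬ (x at v < y at v))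
      ¬Up? v = ¬? (Up? v)
      down : ∀ {v} → ¬ (x at v < y at v) × Differ v → y at v < x at v
      down (¬up , x≢y) = ≤∧≢⇒< (≮⇒≥ ¬up) (λ y≡x → x≢y (toℕ-injective (sym y≡x)))

    hamming : length vertices ≤ dH x y
    hamming = subst (_≤ dH x y) (sym (length-split vertices)) (+-mono-≤ #up≤ #down≤)

    positive : PositiveD D → length vertices ≤ dM x y
    positive pd with agreeing-cycle start rest (Linked.map (compatible-uniform pos pd) closed)
    ... | inj₁ all-up   = subst (_≤ dM x y) (sym all-up)   (≤-trans #up≤ (m≤m⊔n _ _))
    ... | inj₂ all-down = subst (_≤ dM x y) (sym all-down) (≤-trans #down≤ (m≤n⊔m _ _))

    negative : NegativeD D → length vertices ≤ L x y + L x y × length vertices ≤ L y x + L y x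
    negative nd = subst (_≤ L x y + L x y) (sym twice-up)   (+-mono-≤ #up≤ #up≤)
                , subst (_≤ L y x + L y x) (sym twice-down) (+-mono-≤ #down≤ #down≤)
      where
      balanced : #R vertices ≡ #¬R vertices
      balanced = alternating-cycle start rest (Linked.map (compatible-uniform neg nd) closed)
      twice-up : length vertices ≡ #R vertices + #R vertices
      twice-up = trans (length-split vertices) (cong (#R vertices +_) (sym balanced))
      twice-down : length vertices ≡ #¬R vertices + #¬R vertices
      twice-down = trans (length-split vertices) (cong (_+ #¬R vertices) balanced)

⌈/2⌉-≤ : ∀ {γ m} → γ ≤ m + m → ⌈ γ /2⌉ ≤ m
⌈/2⌉-≤ {γ} {m} γ≤2m = subst (⌈ γ /2⌉ ≤_) (sym (n≡⌈n+n/2⌉ m)) (⌈n/2⌉-mono γ≤2m)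

module Separation {n s : ℕ} {D : SignedDigraph n} {γ : ℕ} (girth : IsNonNegGirth D γ)
                  {f : Conf n s → Conf n s} (inF : InF D s f) where

  module _ {x y : Conf n s} (fx : f x ≡ x) (fy : f y ≡ y) (x≢y : x ≢ y) where
    open FixedPointPair D inF fx fy

    cycle : DifferenceCycle
    cycle = difference-cycle x≢y

    γ≤cycle : γ ≤ length (Cycle.vertices cycle)
    γ≤cycle = proj₂ girth _ (nonneg cycle)

  hamming-separation : ∀ x y → f x ≡ x → f y ≡ y → x ≢ y → γ ≤ dH x y
  hamming-separation x y fx fy x≢y =
    ≤-trans (γ≤cycle fx fy x≢y) (FixedPointPair.hamming D inF fx fy (cycle fx fy x≢y))

  positive-separation : PositiveD D → ∀ x y → f x ≡ x → f y ≡ y → x ≢ y → γ ≤ dM x y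
  positive-separation pd x y fx fy x≢y =
    ≤-trans (γ≤cycle fx fy x≢y) (FixedPointPair.positive D inF fx fy (cycle fx fy x≢y) pd)

  negative-separation : NegativeD D →
    ∀ x y → f x ≡ x → f y ≡ y → x ≢ y → ⌈ γ /2⌉ ≤ dm x y
  negative-separation nd x y fx fy x≢y with FixedPointPair.negative D inF fx fy (cycle fx fy x≢y) nd
  ... | ≤2Lxy , ≤2Lyx = ⊓-glb (⌈/2⌉-≤ (≤-trans (γ≤cycle fx fy x≢y) ≤2Lxy))
                              (⌈/2⌉-≤ (≤-trans (γ≤cycle fx fy x≢y) ≤2Lyx))

open Separation

theorem4 : ∀ (n : ℕ) (D : SignedDigraph n) (γ s : ℕ) →
    IsNonNegGirth D γ → 2 ≤ s →
    (∀ f → InF D s f → ∀ x y → f x ≡ x → f y ≡ y → x ≢ y → γ ≤ dH x y) ×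
    (∀ f → InF D s f → numFix f ≤ A dH n γ s) ×
    (NegativeD D → ∀ f → InF D s f → numFix f ≤ A dm n ⌈ γ /2⌉ s) ×
    (PositiveD D → ∀ f → InF D s f → numFix f ≤ A dM n γ s)
theorem4 n D γ s girth _ =
    (λ f inF → hamming-separation girth inF)
  , (λ f inF → numFix≤A f dH γ (hamming-separation girth inF))
  , (λ nd f inF → numFix≤A f dm ⌈ γ /2⌉ (negative-separation girth inF nd))
  , (λ pd f inF → numFix≤A f dM γ (positive-separation girth inF pd))
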